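{- Let $G=(V,E)$ be a connected bipartite graph with unit edge lengths $\ell=1$ and let $C\subseteq E$. (i) If $C$ is a $(1,1)$-contraction, then $C$ is a matching. (ii) If $C=\{e,f\}$ with $e=\{u_1,u_2\}$, $f=\{v_1,v_2\}\in E$, then $C$ is a $(1,1)$-contraction if and only if $\mathrm{dist}_\ell(u_1,v_1)=\mathrm{dist}_\ell(u_2,v_2)$ and $\mathrm{dist}_\ell(u_1,v_2)=\mathrm{dist}_\ell(u_2,v_1)$. (iii) $C$ is a $(1,1)$-contraction if and only if every two-element subset of $C$ is a $(1,1)$-contraction.
   Context: $\ell_C$ is the length function equal to $0$ on $C$ and $\ell$ on $E\setminus C$; $\mathrm{dist}$ denotes shortest-path distance. A $(1,1)$-contraction is a set $C\subseteq E$ with $\mathrm{dist}_{\ell_C}(u,v)\ge\mathrm{dist}_\ell(u,v)-1$ for all $u,v\in V$. -}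

module Defs where

open import Data.Nat using (ℕ; zero; suc; _+_; _≤_)
open import Data.Fin using (Fin; _≟_)
open import Data.Bool using (Bool; true; false; if_then_else_; _∨_; _∧_)
open import Data.Product using (Σ; ∃; _×_; _,_)
open import Data.Sum using (_⊎_)
open import Relation.Binary.PropositionalEquality using (_≡_; _≢_)
open import Relation.Nullary using (¬_)
open import Relation.Nullary.Decidable using (⌊_⌋)

record Graph : Set where
  field
    n     : ℕ
    adj   : Fin n → Fin n → Bool
    sym   : ∀ a b → adj a b ≡ adj b a
    irrefl : ∀ a → adj a a ≡ false
open Graph public

record EdgeSubset (G : Graph) (C : Fin (n G) → Fin (n G) → Bool) : Set where
  field
    sub-sym : ∀ a b → C a b ≡ C b a
    sub-adj : ∀ a b → C a b ≡ true → adj G a b ≡ true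
open EdgeSubset public

data Walk (G : Graph) : Fin (n G) → Fin (n G) → Set where
  [] : ∀ {u} → Walk G u u
  step : ∀ {u w v} → adj G u w ≡ true → Walk G w v → Walk G u v

-- Length of a walk under ℓ_C (edges in C have length 0, other edges 1,
-- i.e. ℓ = 1 is the unit length function).
lenC : (G : Graph) → (Fin (n G) → Fin (n G) → Bool) → ∀ {u v} → Walk G u v → ℕ
lenC G C [] = 0
lenC G C (step {u} {w} _ p) = (if C u w then 0 else 1) + lenC G C p

∅E : (G : Graph) → Fin (n G) → Fin (n G) → Bool
∅E G _ _ = false

IsDistC : (G : Graph) → (Fin (n G) → Fin (n G) → Bool) → Fin (n G) → Fin (n G) → ℕ → Set
IsDistC G C u v d = (Σ (Walk G u v) λ p → lenC G C p ≡ d) × (∀ (p : Walk G u v) → d ≤ lenC G C p)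

IsDist : (G : Graph) → Fin (n G) → Fin (n G) → ℕ → Set
IsDist G = IsDistC G (∅E G)

SameDist : (G : Graph) → Fin (n G) → Fin (n G) → Fin (n G) → Fin (n G) → Set
SameDist G a b c d = ∀ x y → IsDist G a b x → IsDist G c d y → x ≡ y

Connected : Graph → Set
Connected G = ∀ (u v : Fin (n G)) → Walk G u v

Bipartite : Graph → Set
Bipartite G = Σ (Fin (n G) → Bool) λ col → ∀ a b → adj G a b ≡ true → col a ≢ col b

-- C is a (1,1)-contraction: dist_{ℓ_C}(u,v) ≥ dist_ℓ(u,v) - 1 for all u v,
-- written as dist_ℓ(u,v) ≤ dist_{ℓ_C}(u,v) + 1 (equivalent in ℕ).
Contraction11 : (G : Graph) → (Fin (n G) → Fin (n G) → Bool) → Set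
Contraction11 G C = ∀ u v d dC → IsDist G u v d → IsDistC G C u v dC → d ≤ dC + 1

Matching : (G : Graph) → (Fin (n G) → Fin (n G) → Bool) → Set
Matching G C = ∀ a b c → C a b ≡ true → C a c ≡ true → b ≡ c

isEdge : ∀ {m} → Fin m → Fin m → Fin m → Fin m → Bool
isEdge u1 u2 a b = (⌊ a ≟ u1 ⌋ ∧ ⌊ b ≟ u2 ⌋) ∨ (⌊ a ≟ u2 ⌋ ∧ ⌊ b ≟ u1 ⌋)

pairSet : ∀ {m} → Fin m → Fin m → Fin m → Fin m → Fin m → Fin m → Bool
pairSet u1 u2 v1 v2 a b = isEdge u1 u2 a b ∨ isEdge v1 v2 a b

SameEdge : ∀ {m} → Fin m → Fin m → Fin m → Fin m → Set
SameEdge u1 u2 v1 v2 = (u1 ≡ v1 × u2 ≡ v2) ⊎ (u1 ≡ v2 × u2 ≡ v1)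

module Submission where

-- Write ℓ_C(w) for the ℓ_C-length of a walk w and dist for dist_ℓ.  Since a
-- distance is attained by a walk, C is a (1,1)-contraction iff every walk
-- w from u to v satisfies dist(u,v) ≤ ℓ_C(w) + 1 ("C is shortcut-free").
-- Parts (i) and (ii, ⇒) follow by exhibiting a walk that would otherwise be
-- too short, using that in a bipartite graph two walks between the same
-- endpoints never differ in length by exactly one.
--
-- The heart of the proof is a characterisation of shortcuts.  Call a
-- configuration critical if it consists of edges ab, cd ∈ C and a walk s
-- from b to c with dist(a,d) = |s| + 2.  Such a configuration contradicts
-- shortcut-freeness of any C' ⊇ {ab, cd}, since the walk a b s c d has
-- ℓ_{C'}-length at most |s|.  Conversely, following a walk w with
-- ℓ_C(w) + 2 ≤ dist(x,y) vertex by vertex while comparing the distance from x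
-- with the ℓ_C-length travelled so far exposes a critical configuration.
-- Hence C is a contraction iff it has no critical configuration, and (ii, ⇐)
-- and (iii) become statements about critical configurations.

open import Defs
open import Data.Bool using (Bool; true; false; not; if_then_else_; _∨_)
open import Data.Bool.Properties using (not-¬; ¬-not; ∨-zeroʳ)
open import Data.Fin using (Fin; _≟_)
open import Data.Nat using (ℕ; zero; suc; _+_; _≤_; _<_; z≤n; s≤s; _≤?_)
open import Data.Nat.Induction using (<-wellFounded)
open import Data.Nat.Properties
  using (≤-trans; ≤-refl; ≤-reflexive; ≤-antisym; ≤-pred; ≰⇒>; 1+n≰n; n≤1+n;
         +-comm; +-assoc; +-suc; +-identityʳ; +-mono-≤; +-monoˡ-≤; +-cancelˡ-≤;
         <-cmp; ≤∧≢⇒<; suc-injective; module ≤-Reasoning)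
open import Data.Product using (Σ; _×_; _,_; proj₂)
open import Data.Sum using (_⊎_; inj₁; inj₂)
open import Data.Empty using (⊥; ⊥-elim)
open import Function.Bundles using (_⇔_; mk⇔)
open import Induction.WellFounded using (Acc; acc)
open import Relation.Binary using (tri<; tri≈; tri>)
open import Relation.Binary.PropositionalEquality
  using (_≡_; _≢_; refl; trans; cong; subst; ≢-sym; module ≡-Reasoning)
  renaming (sym to ≡-sym)
open import Relation.Nullary using (¬_; yes; no)
open import Relation.Nullary.Decidable using (⌊_⌋; decidable-stable)

cost : Bool → ℕ
cost b = if b then 0 else 1

cost-antitone : ∀ {b b′} → (b′ ≡ true → b ≡ true) → cost b ≤ cost b′
cost-antitone {true}  _   = z≤n
cost-antitone {false} {true} sub with sub refl
... | ()
cost-antitone {false} {false} _ = ≤-refl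

-- Moving the cost of the next edge from the remaining walk into the budget.
cost-shift : ∀ b L R → L + (cost b + R) ≡ cost b + L + R
cost-shift true  L R = refl
cost-shift false L R = +-suc L R

off-by-two : ∀ {m} → m ≢ 2 + m
off-by-two {m} e = 1+n≰n (≤-trans (n≤1+n (suc m)) (≤-reflexive (≡-sym e)))

-- Iterated negation; it tracks the colour along a walk in a 2-colouring.
flips : ℕ → Bool → Bool
flips zero    b = b
flips (suc k) b = flips k (not b)

flips-not : ∀ k b → flips k (not b) ≡ not (flips k b)
flips-not zero    b = refl
flips-not (suc k) b = flips-not k (not b)

∨-true : ∀ {a b} → a ∨ b ≡ true → a ≡ true ⊎ b ≡ true
∨-true {true}  _ = inj₁ refl
∨-true {false} e = inj₂ e

≟-refl : ∀ {m} (x : Fin m) → ⌊ x ≟ x ⌋ ≡ true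
≟-refl x with x ≟ x
... | yes _ = refl
... | no x≢x = ⊥-elim (x≢x refl)

sameEdge-swap : ∀ {m} {x y u1 u2 : Fin m} → SameEdge x y u1 u2 → SameEdge y x u1 u2
sameEdge-swap (inj₁ (p , q)) = inj₂ (q , p)
sameEdge-swap (inj₂ (p , q)) = inj₁ (q , p)

sameEdge-trans : ∀ {m} {a b c d u1 u2 : Fin m} →
                 SameEdge a b u1 u2 → SameEdge c d u1 u2 → SameEdge a b c d
sameEdge-trans (inj₁ (refl , refl)) (inj₁ (refl , refl)) = inj₁ (refl , refl)
sameEdge-trans (inj₁ (refl , refl)) (inj₂ (refl , refl)) = inj₂ (refl , refl)
sameEdge-trans (inj₂ (refl , refl)) (inj₁ (refl , refl)) = inj₂ (refl , refl)
sameEdge-trans (inj₂ (refl , refl)) (inj₂ (refl , refl)) = inj₁ (refl , refl)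

orientation-member : ∀ {m} (R : Fin m → Fin m → Bool) → (∀ a b → R a b ≡ R b a) →
                     ∀ {x y u1 u2} → R u1 u2 ≡ true → SameEdge x y u1 u2 → R x y ≡ true
orientation-member R R-sym r (inj₁ (refl , refl)) = r
orientation-member R R-sym r (inj₂ (refl , refl)) = trans (R-sym _ _) r

isEdge-sound : ∀ {m} (u1 u2 x y : Fin m) → isEdge u1 u2 x y ≡ true → SameEdge x y u1 u2
isEdge-sound u1 u2 x y with x ≟ u1 | y ≟ u2 | x ≟ u2 | y ≟ u1
... | yes p | yes q | _     | _     = λ _ → inj₁ (p , q)
... | _     | _     | yes p | yes q = λ _ → inj₂ (p , q)
... | no _  | _     | no _  | _     = λ ()
... | no _  | _     | yes _ | no _  = λ ()
... | yes _ | no _  | no _  | _     = λ ()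
... | yes _ | no _  | yes _ | no _  = λ ()

isEdge-complete : ∀ {m} {u1 u2 x y : Fin m} → SameEdge x y u1 u2 → isEdge u1 u2 x y ≡ true
isEdge-complete {x = x} {y} (inj₁ (refl , refl)) rewrite ≟-refl x | ≟-refl y = refl
isEdge-complete {x = x} {y} (inj₂ (refl , refl)) rewrite ≟-refl x | ≟-refl y = ∨-zeroʳ _

pairSet-member : ∀ {m} {u1 u2 v1 v2 x y : Fin m} → pairSet u1 u2 v1 v2 x y ≡ true →
                 SameEdge x y u1 u2 ⊎ SameEdge x y v1 v2
pairSet-member {u1 = u1} {u2} {v1} {v2} {x} {y} e with ∨-true e
... | inj₁ eu = inj₁ (isEdge-sound u1 u2 x y eu)
... | inj₂ ev = inj₂ (isEdge-sound v1 v2 x y ev)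

pairSet-left : ∀ {m} (u1 u2 v1 v2 : Fin m) {x y} → SameEdge x y u1 u2 → pairSet u1 u2 v1 v2 x y ≡ true
pairSet-left _ _ _ _ e rewrite isEdge-complete e = refl

pairSet-right : ∀ {m} (u1 u2 v1 v2 : Fin m) {x y} → SameEdge x y v1 v2 → pairSet u1 u2 v1 v2 x y ≡ true
pairSet-right _ _ _ _ e rewrite isEdge-complete e = ∨-zeroʳ _

module _ (G : Graph) where

  private
    V : Set
    V = Fin (n G)

    W : V → V → Set
    W = Walk G

    len : ∀ {u v} → W u v → ℕ
    len = lenC G (∅E G)

  symAdj : ∀ {a b} → adj G a b ≡ true → adj G b a ≡ true
  symAdj {a} {b} h = trans (Graph.sym G b a) h

  _++w_ : ∀ {u v w} → W u v → W v w → W u w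
  []         ++w q = q
  step h p   ++w q = step h (p ++w q)

  lenC-++ : ∀ C {u v w} (p : W u v) (q : W v w) → lenC G C (p ++w q) ≡ lenC G C p + lenC G C q
  lenC-++ C [] q = refl
  lenC-++ C (step {u} {x} h p) q =
    trans (cong (cost (C u x) +_) (lenC-++ C p q)) (≡-sym (+-assoc (cost (C u x)) _ _))

  len-snoc : ∀ {u v w} (p : W u v) (h : adj G v w ≡ true) → len (p ++w step h []) ≡ suc (len p)
  len-snoc p h = trans (lenC-++ (∅E G) p (step h [])) (+-comm (len p) 1)

  reverse : ∀ {u v} → W u v → W v u
  reverse []         = []
  reverse (step h p) = reverse p ++w step (symAdj h) []

  len-reverse : ∀ {u v} (p : W u v) → len (reverse p) ≡ len p
  len-reverse []         = refl
  len-reverse (step h p) = trans (len-snoc (reverse p) (symAdj h)) (cong suc (len-reverse p))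

  lenC-antitone : ∀ {C C′} → (∀ x y → C′ x y ≡ true → C x y ≡ true) →
                  ∀ {u v} (p : W u v) → lenC G C p ≤ lenC G C′ p
  lenC-antitone sub []                 = z≤n
  lenC-antitone sub (step {u} {x} h p) = +-mono-≤ (cost-antitone (sub u x)) (lenC-antitone sub p)

  lenC≤len : ∀ C {u v} (p : W u v) → lenC G C p ≤ len p
  lenC≤len C = lenC-antitone (λ _ _ ())

  detour : ∀ {a b c d} → adj G a b ≡ true → W b c → adj G c d ≡ true → W a d
  detour hab s hcd = step hab (s ++w step hcd [])

  len-detour : ∀ {a b c d} (hab : adj G a b ≡ true) (s : W b c) (hcd : adj G c d ≡ true) →
               len (detour hab s hcd) ≡ 2 + len s
  len-detour hab s hcd = cong suc (len-snoc s hcd)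

  lenC-detour : ∀ C {a b c d} (hab : adj G a b ≡ true) (s : W b c) (hcd : adj G c d ≡ true) →
                C a b ≡ true → C c d ≡ true → lenC G C (detour hab s hcd) ≡ lenC G C s
  lenC-detour C {a} {b} {c} {d} hab s hcd cab ccd = begin
    cost (C a b) + lenC G C (s ++w step hcd [])  ≡⟨ cong (λ t → cost t + lenC G C (s ++w step hcd [])) cab ⟩
    lenC G C (s ++w step hcd [])                 ≡⟨ lenC-++ C s (step hcd []) ⟩
    lenC G C s + (cost (C c d) + 0)              ≡⟨ cong (λ t → lenC G C s + (cost t + 0)) ccd ⟩
    lenC G C s + 0                               ≡⟨ +-identityʳ _ ⟩
    lenC G C s                                   ∎
    where open ≡-Reasoning

  -- Distances.  Shortest walks exist up to double negation (least number
  -- principle over the ℓ_C-lengths), which suffices for decidable goals.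

  shortest-exists : ∀ C {u v} → W u v → ¬ ¬ Σ ℕ (IsDistC G C u v)
  shortest-exists C p = go p (<-wellFounded (lenC G C p))
    where
    go : ∀ {u v} (p : W u v) → Acc _<_ (lenC G C p) → ¬ ¬ Σ ℕ (IsDistC G C u v)
    go p (acc shorter) none = none (lenC G C p , (p , refl) , minimal)
      where
      minimal : ∀ q → lenC G C p ≤ lenC G C q
      minimal q = decidable-stable (lenC G C p ≤? lenC G C q) λ p≰q →
                    go q (shorter (≰⇒> p≰q)) none

  dist-walk : ∀ {C u v D} → IsDistC G C u v D → W u v
  dist-walk ((p , _) , _) = p

  dist-walk-length : ∀ {C u v D} (du : IsDistC G C u v D) → lenC G C (dist-walk du) ≡ D
  dist-walk-length ((_ , e) , _) = e

  dist-unique : ∀ {C x y D D′} → IsDistC G C x y D → IsDistC G C x y D′ → D ≡ D′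
  dist-unique {D = D} {D′} ((p , e) , lb) ((p′ , e′) , lb′) =
    ≤-antisym (subst (D ≤_) e′ (lb p′)) (subst (D′ ≤_) e (lb′ p))

  dist-reverse : ∀ {a b D} → IsDist G a b D → IsDist G b a D
  dist-reverse ((p , e) , lb) =
    (reverse p , trans (len-reverse p) e) , λ q → subst (_ ≤_) (len-reverse q) (lb (reverse q))

  dist-triangle : ∀ {x a d Da Dd} → IsDist G x a Da → IsDist G x d Dd → (q : W a d) → Dd ≤ Da + len q
  dist-triangle ((p , e) , _) (_ , lb) q =
    subst (_ ≤_) (trans (lenC-++ _ p q) (cong (_+ len q) e)) (lb (p ++w q))

  dist-step : ∀ {x z z′ D D′} → IsDist G x z D → IsDist G x z′ D′ → adj G z z′ ≡ true → D′ ≤ suc D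
  dist-step {D = D} {D′} dz dz′ h = subst (D′ ≤_) (+-comm D 1) (dist-triangle dz dz′ (step h []))

  far-apart : ∀ {u v} m → (∀ (q : W u v) → 2 + m ≤ len q) → ¬ (u ≡ v ⊎ adj G u v ≡ true)
  far-apart m far (inj₁ refl) with far []
  ... | ()
  far-apart m far (inj₂ h) with far (step h [])
  ... | s≤s ()

  ShortcutFree : (Fin (n G) → Fin (n G) → Bool) → Set
  ShortcutFree C = ∀ {u v D} → IsDist G u v D → (w : W u v) → D ≤ lenC G C w + 1

  contraction⇒shortcutFree : ∀ {C} → Contraction11 G C → ShortcutFree C
  contraction⇒shortcutFree {C} CC {u} {v} {D} du w =
    decidable-stable (D ≤? lenC G C w + 1) λ D≰ →
      shortest-exists C w λ (dC , duC) →
        D≰ (≤-trans (CC u v D dC du duC) (+-monoˡ-≤ 1 (proj₂ duC w)))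

  shortcutFree⇒contraction : ∀ {C} → ShortcutFree C → Contraction11 G C
  shortcutFree⇒contraction free u v D dC du ((w , e) , _) = subst (λ k → D ≤ k + 1) e (free du w)

  contraction-antitone : ∀ {C C′} → (∀ x y → C′ x y ≡ true → C x y ≡ true) →
                         Contraction11 G C → Contraction11 G C′
  contraction-antitone sub CC = shortcutFree⇒contraction λ du w →
    ≤-trans (contraction⇒shortcutFree CC du w) (+-monoˡ-≤ 1 (lenC-antitone sub w))

  colour-along : ∀ ((col , proper) : Bipartite G) {u v} (p : W u v) → col v ≡ flips (len p) (col u)
  colour-along _ [] = refl
  colour-along (col , proper) (step {u} {w} h p) =
    trans (colour-along (col , proper) p) (cong (flips (len p)) (¬-not (≢-sym (proper u w h))))

  walk-parity : Bipartite G → ∀ {u v} (p q : W u v) → len p ≢ suc (len q)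
  walk-parity (col , proper) {u} {v} p q e = not-¬ refl (begin
    flips (len q) (col u)        ≡⟨ ≡-sym (colour-along (col , proper) q) ⟩
    col v                        ≡⟨ colour-along (col , proper) p ⟩
    flips (len p) (col u)        ≡⟨ cong (λ k → flips k (col u)) e ⟩
    flips (len q) (not (col u))  ≡⟨ flips-not (len q) (col u) ⟩
    not (flips (len q) (col u))  ∎)
    where open ≡-Reasoning

  distance-step : Bipartite G → ∀ {x z z′ D D′} → IsDist G x z D → IsDist G x z′ D′ →
                  adj G z z′ ≡ true → D′ ≡ suc D ⊎ D ≡ suc D′
  distance-step bip {D = D} {D′} dz dz′ h with <-cmp D D′
  ... | tri< D<D′ _ _ = inj₁ (≤-antisym (dist-step dz dz′ h) D<D′)
  ... | tri> _ _ D′<D = inj₂ (≤-antisym (dist-step dz′ dz (symAdj h)) D′<D)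
  ... | tri≈ _ refl _ = ⊥-elim (walk-parity bip (dist-walk dz ++w step h []) (dist-walk dz′) (begin
    len (dist-walk dz ++w step h [])  ≡⟨ len-snoc (dist-walk dz) h ⟩
    suc (len (dist-walk dz))          ≡⟨ cong suc (dist-walk-length dz) ⟩
    suc D                             ≡⟨ cong suc (≡-sym (dist-walk-length dz′)) ⟩
    suc (len (dist-walk dz′))         ∎))
    where open ≡-Reasoning

  record Critical (C : Fin (n G) → Fin (n G) → Bool) : Set where
    field
      {a b c d} : V
      ab-edge   : adj G a b ≡ true
      cd-edge   : adj G c d ≡ true
      ab-in-C   : C a b ≡ true
      cd-in-C   : C c d ≡ true
      between   : W b c
      far       : ∀ (q : W a d) → 2 + len between ≤ len q

    dist-ad : IsDist G a d (2 + len between)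
    dist-ad = (detour ab-edge between cd-edge , len-detour ab-edge between cd-edge) , far

    dist-bc : IsDist G b c (len between)
    dist-bc = (between , refl) , λ q →
      ≤-pred (≤-pred (subst (2 + len between ≤_) (len-detour ab-edge q cd-edge) (far (detour ab-edge q cd-edge))))

    distinct : ¬ SameEdge a b c d
    distinct (inj₁ (_ , b≡d)) = far-apart _ far (inj₂ (subst (λ t → adj G a t ≡ true) b≡d ab-edge))
    distinct (inj₂ (a≡d , _)) = far-apart _ far (inj₁ a≡d)

  open Critical

  critical-transfer : ∀ {C C′} (k : Critical C) → C′ (a k) (b k) ≡ true → C′ (c k) (d k) ≡ true → Critical C′
  critical-transfer k ab cd = record
    { ab-edge = ab-edge k ; cd-edge = cd-edge k ; ab-in-C = ab ; cd-in-C = cd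
    ; between = between k ; far = far k }

  -- A critical configuration is a shortcut: the detour has ℓ_C-length ≤ |s|.
  critical-obstructs : ∀ {C} → Critical C → ¬ Contraction11 G C
  critical-obstructs {C} k CC = 1+n≰n (≤-pred (begin
    2 + m                          ≤⟨ contraction⇒shortcutFree CC (dist-ad k) w ⟩
    lenC G C w + 1                 ≡⟨ cong (_+ 1) (lenC-detour C (ab-edge k) (between k) (cd-edge k)
                                                     (ab-in-C k) (cd-in-C k)) ⟩
    lenC G C (between k) + 1       ≤⟨ +-monoˡ-≤ 1 (lenC≤len C (between k)) ⟩
    m + 1                          ≡⟨ +-comm m 1 ⟩
    1 + m                          ∎))
    where
    open ≤-Reasoning
    m : ℕ
    m = len (between k)
    w : W (a k) (d k)
    w = detour (ab-edge k) (between k) (cd-edge k)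

  -- Fix a source x and follow a walk from x,
  -- with L the ℓ_C-length travelled so far.  The current vertex z is either
  --   behind: dist(x,z) ≤ L, or
  --   ahead:  dist(x,z) = L + 1, the lead having been gained on a C-edge ab
  --           after which the walk s moved strictly away from x.
  -- Since distances of adjacent vertices differ by exactly one, a step can only
  -- go ahead along a C-edge, stays ahead along a non-C-edge moving away from x,
  -- and otherwise ends behind -- except that a C-edge zz′ taken while ahead and
  -- moving away from x completes the critical configuration (ab, s, zz′).
  -- So without critical configurations no walk ends with dist(x,y) ≥ L + 2.

  module Tracking (bip : Bipartite G) {C : V → V → Bool} (noCritical : ¬ Critical C) (x : V) where

    data Phase (z : V) (L : ℕ) : Set where
      behind : ∀ {D} → IsDist G x z D → D ≤ L → Phase z L
      ahead  : ∀ {a b Da} → adj G a b ≡ true → C a b ≡ true → IsDist G x a Da →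
               (s : W b z) → Da + len s ≤ L → IsDist G x z (suc L) → Phase z L

    phase-walk : ∀ {z L} → Phase z L → W x z
    phase-walk (behind dz _)        = dist-walk dz
    phase-walk (ahead _ _ _ _ _ dz) = dist-walk dz

    phase-bound : ∀ {z L D} → Phase z L → IsDist G x z D → D ≤ suc L
    phase-bound (behind dz D≤L) dz′       = ≤-trans (≤-reflexive (dist-unique dz′ dz)) (≤-trans D≤L (n≤1+n _))
    phase-bound (ahead _ _ _ _ _ dz) dz′ = ≤-reflexive (dist-unique dz′ dz)

    advance-free : ∀ {z z′ L D′} → Phase z L → adj G z z′ ≡ true → IsDist G x z′ D′ → Phase z′ (suc L)
    advance-free (behind dz D≤L) h dz′ = behind dz′ (≤-trans (dist-step dz dz′ h) (s≤s D≤L))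
    advance-free {L = L} (ahead {Da = Da} hab cab da s bound dz) h dz′ with distance-step bip dz dz′ h
    ... | inj₁ D′≡2+L = ahead hab cab da (s ++w step h []) extended (subst (IsDist G x _) D′≡2+L dz′)
      where
      extended : Da + len (s ++w step h []) ≤ suc L
      extended = subst (_≤ suc L) (≡-sym (trans (cong (Da +_) (len-snoc s h)) (+-suc Da (len s)))) (s≤s bound)
    ... | inj₂ 1+L≡1+D′ = behind dz′ (≤-trans (≤-reflexive (≡-sym (suc-injective 1+L≡1+D′))) (n≤1+n L))

    -- Stepping along an edge of C: the budget stays; moving away from x while
    -- ahead would complete a critical configuration.
    advance-contracted : ∀ {z z′ L D′} → Phase z L → (h : adj G z z′ ≡ true) → C z z′ ≡ true →
                         IsDist G x z′ D′ → Phase z′ L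
    advance-contracted {L = L} {D′} (behind {D} dz D≤L) h czz′ dz′ with D′ ≤? L
    ... | yes D′≤L = behind dz′ D′≤L
    ... | no  D′≰L = ahead h czz′ dz [] (subst (_≤ L) (≡-sym (+-identityʳ D)) D≤L)
                       (subst (IsDist G x _) (≤-antisym (≤-trans (dist-step dz dz′ h) (s≤s D≤L)) (≰⇒> D′≰L)) dz′)
    advance-contracted {L = L} (ahead {Da = Da} hab cab da s bound dz) h czz′ dz′ with distance-step bip dz dz′ h
    ... | inj₂ 1+L≡1+D′ = behind dz′ (≤-reflexive (≡-sym (suc-injective 1+L≡1+D′)))
    ... | inj₁ D′≡2+L = ⊥-elim (noCritical record
            { ab-edge = hab ; cd-edge = h ; ab-in-C = cab ; cd-in-C = czz′ ; between = s ; far = far′ })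
      where
      far′ : ∀ q → 2 + len s ≤ len q
      far′ q = +-cancelˡ-≤ Da _ _ (begin
        Da + (2 + len s)   ≡⟨ trans (+-suc Da (suc (len s))) (cong suc (+-suc Da (len s))) ⟩
        2 + (Da + len s)   ≤⟨ s≤s (s≤s bound) ⟩
        2 + L              ≡⟨ ≡-sym D′≡2+L ⟩
        _                  ≤⟨ dist-triangle da dz′ q ⟩
        Da + len q         ∎)
        where open ≤-Reasoning

    advance : ∀ {z z′ L D′} → Phase z L → (h : adj G z z′ ≡ true) → IsDist G x z′ D′ →
              Phase z′ (cost (C z z′) + L)
    advance {z} {z′} ph h dz′ with C z z′ in czz′
    ... | false = advance-free ph h dz′
    ... | true  = advance-contracted ph h czz′ dz′

    run : ∀ {y Dy z L} → IsDist G x y Dy → Phase z L → (r : W z y) → 2 + (L + lenC G C r) ≤ Dy → ⊥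
    run {Dy = Dy} {L = L} dy ph [] gap =
      1+n≰n (≤-pred (≤-trans (subst (λ k → 2 + k ≤ Dy) (+-identityʳ L) gap) (phase-bound ph dy)))
    run {Dy = Dy} {z} {L} dy ph (step {w = z′} h r) gap =
      shortest-exists (∅E G) (phase-walk ph ++w step h []) λ (D′ , dz′) →
        run dy (advance ph h dz′) r (subst (λ k → 2 + k ≤ Dy) (cost-shift (C z z′) L (lenC G C r)) gap)

    no-shortcut-from : ∀ {y D} → IsDist G x y D → (w : W x y) → D ≤ lenC G C w + 1
    no-shortcut-from {D = D} dy w = decidable-stable (D ≤? lenC G C w + 1) λ D≰ →
      run dy (behind (([] , refl) , λ _ → z≤n) z≤n) w
        (subst (_≤ D) (cong suc (+-comm (lenC G C w) 1)) (≰⇒> D≰))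

  noCritical⇒contraction : Bipartite G → ∀ {C} → ¬ Critical C → Contraction11 G C
  noCritical⇒contraction bip noCritical =
    shortcutFree⇒contraction λ {u} du w → Tracking.no-shortcut-from bip noCritical u du w

  -- (i) Two C-edges ab, ac with b ≠ c would contract a path between b and c,
  -- which are at distance 2 since b, c are distinct and (by parity) non-adjacent.

  two-apart : ∀ {u v} → u ≢ v → ¬ adj G u v ≡ true → (q : W u v) → 2 ≤ len q
  two-apart u≢v _    []                  = ⊥-elim (u≢v refl)
  two-apart _   ¬adj (step h [])         = ⊥-elim (¬adj h)
  two-apart _   _    (step _ (step _ _)) = s≤s (s≤s z≤n)

  contraction⇒matching : Bipartite G → ∀ {C} → EdgeSubset G C → Contraction11 G C → Matching G C
  contraction⇒matching bip {C} S CC a b c ab ac = decidable-stable (b ≟ c) λ b≢c →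
      two-gt-one (subst (λ k → 2 ≤ k + 1) w-free (contraction⇒shortcutFree CC (dist-two b≢c) w))
    where
    hba : adj G b a ≡ true
    hba = symAdj (sub-adj S a b ab)
    hac : adj G a c ≡ true
    hac = sub-adj S a c ac
    w : W b c
    w = detour hba [] hac
    w-free : lenC G C w ≡ 0
    w-free = lenC-detour C hba [] hac (trans (sub-sym S b a) ab) ac
    dist-two : b ≢ c → IsDist G b c 2
    dist-two b≢c = (w , refl) , two-apart b≢c (λ h → walk-parity bip w (step h []) refl)
    two-gt-one : ¬ 2 ≤ 0 + 1
    two-gt-one (s≤s ())

  -- (ii, ⇒) If C contains the edges ba and cd, then dist(b,d) ≤ dist(a,c):
  -- the detour b a ⋯ c d shows dist(b,d) ≤ dist(a,c) + 1, and parity excludes equality.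
  contracted-ends-closer : Bipartite G → ∀ {C a b c d x y} → Contraction11 G C →
                           adj G b a ≡ true → adj G c d ≡ true → C b a ≡ true → C c d ≡ true →
                           IsDist G a c x → IsDist G b d y → y ≤ x
  contracted-ends-closer bip {C} {x = x} {y} CC hba hcd cba ccd ((pac , epac) , _) dbd@((pbd , epbd) , _) =
    ≤-pred (≤∧≢⇒< bound not-one-more)
    where
    w : W _ _
    w = detour hba pac hcd
    bound : y ≤ suc x
    bound = begin
      y                ≤⟨ contraction⇒shortcutFree CC dbd w ⟩
      lenC G C w + 1   ≡⟨ cong (_+ 1) (lenC-detour C hba pac hcd cba ccd) ⟩
      lenC G C pac + 1 ≤⟨ +-monoˡ-≤ 1 (lenC≤len C pac) ⟩
      len pac + 1      ≡⟨ cong (_+ 1) epac ⟩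
      x + 1            ≡⟨ +-comm x 1 ⟩
      suc x            ∎
      where open ≤-Reasoning
    not-one-more : y ≢ suc x
    not-one-more y≡1+x = walk-parity bip w pbd (begin
      len w            ≡⟨ len-detour hba pac hcd ⟩
      2 + len pac      ≡⟨ cong (2 +_) epac ⟩
      2 + x            ≡⟨ cong suc (≡-sym y≡1+x) ⟩
      suc y            ≡⟨ cong suc (≡-sym epbd) ⟩
      suc (len pbd)    ∎)
      where open ≡-Reasoning

  contraction⇒sameDist : Bipartite G → ∀ {C a b c d} → Contraction11 G C →
                         adj G a b ≡ true → adj G c d ≡ true →
                         C a b ≡ true → C b a ≡ true → C c d ≡ true → C d c ≡ true → SameDist G a c b d
  contraction⇒sameDist bip CC hab hcd cab cba ccd cdc _ _ dac dbd =
    ≤-antisym (contracted-ends-closer bip CC hab (symAdj hcd) cab cdc dbd dac)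
              (contracted-ends-closer bip CC (symAdj hab) hcd cba ccd dac dbd)

  -- (ii, ⇐) Under the distance conditions, for any orientations (a,b) of
  -- {u1,u2} and (c,d) of {v1,v2} we have dist(b,c) = dist(a,d); so no
  -- critical configuration (which needs dist(a,d) = dist(b,c) + 2) exists.
  orientation-sameDist : ∀ {u1 u2 v1 v2 a b c d x y} →
                         SameDist G u1 v1 u2 v2 → SameDist G u1 v2 u2 v1 →
                         SameEdge a b u1 u2 → SameEdge c d v1 v2 →
                         IsDist G b c x → IsDist G a d y → x ≡ y
  orientation-sameDist S1 S2 (inj₁ (refl , refl)) (inj₁ (refl , refl)) dbc dad = ≡-sym (S2 _ _ dad dbc)
  orientation-sameDist S1 S2 (inj₁ (refl , refl)) (inj₂ (refl , refl)) dbc dad = ≡-sym (S1 _ _ dad dbc)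
  orientation-sameDist S1 S2 (inj₂ (refl , refl)) (inj₁ (refl , refl)) dbc dad = S1 _ _ dbc dad
  orientation-sameDist S1 S2 (inj₂ (refl , refl)) (inj₂ (refl , refl)) dbc dad = S2 _ _ dbc dad

  pairSet-noCritical : ∀ {u1 u2 v1 v2} → SameDist G u1 v1 u2 v2 → SameDist G u1 v2 u2 v1 →
                       ¬ Critical (pairSet u1 u2 v1 v2)
  pairSet-noCritical S1 S2 k with pairSet-member (ab-in-C k) | pairSet-member (cd-in-C k)
  ... | inj₁ e | inj₁ f = distinct k (sameEdge-trans e f)
  ... | inj₂ e | inj₂ f = distinct k (sameEdge-trans e f)
  ... | inj₁ e | inj₂ f = off-by-two (orientation-sameDist S1 S2 e f (dist-bc k) (dist-ad k))
  ... | inj₂ e | inj₁ f = off-by-two (orientation-sameDist S1 S2 (sameEdge-swap f) (sameEdge-swap e)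
                                        (dist-reverse (dist-bc k)) (dist-reverse (dist-ad k)))

  pair-criterion : Bipartite G → ∀ {u1 u2 v1 v2} → adj G u1 u2 ≡ true → adj G v1 v2 ≡ true →
                   Contraction11 G (pairSet u1 u2 v1 v2) ⇔ (SameDist G u1 v1 u2 v2 × SameDist G u1 v2 u2 v1)
  pair-criterion bip {u1} {u2} {v1} {v2} h1 h2 = mk⇔
    (λ CC → contraction⇒sameDist bip CC h1 h2 u12 u21 v12 v21
          , contraction⇒sameDist bip CC h1 (symAdj h2) u12 u21 v21 v12)
    (λ (S1 , S2) → noCritical⇒contraction bip (pairSet-noCritical S1 S2))
    where
    P : Fin (n G) → Fin (n G) → Bool
    P = pairSet u1 u2 v1 v2
    u12 : P u1 u2 ≡ true
    u12 = pairSet-left u1 u2 v1 v2 (inj₁ (refl , refl))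
    u21 : P u2 u1 ≡ true
    u21 = pairSet-left u1 u2 v1 v2 (inj₂ (refl , refl))
    v12 : P v1 v2 ≡ true
    v12 = pairSet-right u1 u2 v1 v2 (inj₁ (refl , refl))
    v21 : P v2 v1 ≡ true
    v21 = pairSet-right u1 u2 v1 v2 (inj₂ (refl , refl))

  -- (iii) Subsets of contractions are contractions; conversely a critical
  -- configuration of C is also critical for the pair of its two (distinct) edges.
  pairwise-criterion : Bipartite G → ∀ {C} → EdgeSubset G C →
                       Contraction11 G C ⇔ (∀ u1 u2 v1 v2 → C u1 u2 ≡ true → C v1 v2 ≡ true →
                                              ¬ SameEdge u1 u2 v1 v2 → Contraction11 G (pairSet u1 u2 v1 v2))
  pairwise-criterion bip {C} S = mk⇔
    (λ CC u1 u2 v1 v2 c1 c2 _ → contraction-antitone (pair⊆C c1 c2) CC)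
    (λ pairs → noCritical⇒contraction bip λ k →
       critical-obstructs (critical-transfer k (pairSet-left (a k) (b k) (c k) (d k) (inj₁ (refl , refl)))
                                                 (pairSet-right (a k) (b k) (c k) (d k) (inj₁ (refl , refl))))
                          (pairs _ _ _ _ (ab-in-C k) (cd-in-C k) (distinct k)))
    where
    pair⊆C : ∀ {u1 u2 v1 v2} → C u1 u2 ≡ true → C v1 v2 ≡ true →
             ∀ x y → pairSet u1 u2 v1 v2 x y ≡ true → C x y ≡ true
    pair⊆C c1 c2 x y e with pairSet-member e
    ... | inj₁ o = orientation-member C (sub-sym S) c1 o
    ... | inj₂ o = orientation-member C (sub-sym S) c2 o

lemma21 : (G : Graph) → Connected G → Bipartite G →
          ((C : Fin (n G) → Fin (n G) → Bool) → EdgeSubset G C →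
             Contraction11 G C → Matching G C)
          × ((u1 u2 v1 v2 : Fin (n G)) → adj G u1 u2 ≡ true → adj G v1 v2 ≡ true →
             (Contraction11 G (pairSet u1 u2 v1 v2)
               ⇔ (SameDist G u1 v1 u2 v2 × SameDist G u1 v2 u2 v1)))
          × ((C : Fin (n G) → Fin (n G) → Bool) → EdgeSubset G C →
             (Contraction11 G C
               ⇔ (∀ u1 u2 v1 v2 → C u1 u2 ≡ true → C v1 v2 ≡ true →
                    ¬ SameEdge u1 u2 v1 v2 →
                    Contraction11 G (pairSet u1 u2 v1 v2))))
lemma21 G _ bip =
    (λ C S → contraction⇒matching G bip S)
  , (λ u1 u2 v1 v2 → pair-criterion G bip)
  , (λ C S → pairwise-criterion G bip S)
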